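{- Let $p$ be an even positive integer and $\tau,i,j$ non-negative integers. Let $\mu=\frac{p^2}{4}+2p+2$, $\gamma=2\mu-\left(\frac p2+4\right)$, $m=\mu+\tau\frac p2$, $g=\gamma+\tau(p-1)$, $c=p\mu+\tau\left(\frac{p^2}{2}-1\right)$, $S(p,\tau)=\langle m,g,g+1\rangle_c$; and let $m^{(i,j)}=m+j\frac p2$, $g^{(i,j)}=g+j(p-1)+i\,m^{(i,j)}$, $c^{(i,j)}=c+j\frac{p^2}{2}+i\left(\frac p2+1\right)m^{(i,j)}$, $S^{(i,j)}(p,\tau)=\langle m^{(i,j)},g^{(i,j)},g^{(i,j)}+1\rangle_{c^{(i,j)}}$. Then $$q(S^{(i,j)}(p,\tau))=q(S(p,\tau))+i\left(\frac p2+1\right).$$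
   Context: A numerical semigroup is a submonoid of $(\mathbb N,+)$ with finite complement. For integers $a_1,\dots,a_r$ and $t$, $\langle a_1,\dots,a_r\rangle_t$ denotes the smallest numerical semigroup containing $a_1,\dots,a_r$ and all integers $\ge t$. For a numerical semigroup $S$ with conductor $c(S)$ (smallest integer such that all integers $\ge c(S)$ are in $S$) and multiplicity $m(S)$ (least positive element), $q(S)=\lceil c(S)/m(S)\rceil$. -}

module Defs where

open import Data.Nat using (ℕ; zero; suc; _+_; _*_; _∸_; _≤_; _<_)
open import Data.Nat.DivMod using (_/_)
open import Data.Product using (_×_)

Subset : Set₁
Subset = ℕ → Set

-- ⟨ a , b , d ⟩_t : the smallest submonoid of (ℕ,+) containing a, b, d
-- and every integer ≥ t (inductively generated closure).
data ⟨_,_,_⟩[_] (a b d t : ℕ) : ℕ → Set where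
  zero∈ : ⟨ a , b , d ⟩[ t ] 0
  a∈    : ⟨ a , b , d ⟩[ t ] a
  b∈    : ⟨ a , b , d ⟩[ t ] b
  d∈    : ⟨ a , b , d ⟩[ t ] d
  big∈  : ∀ {n} → t ≤ n → ⟨ a , b , d ⟩[ t ] n
  add∈  : ∀ {x y} → ⟨ a , b , d ⟩[ t ] x → ⟨ a , b , d ⟩[ t ] y
        → ⟨ a , b , d ⟩[ t ] (x + y)

IsConductor : Subset → ℕ → Set
IsConductor S c = (∀ n → c ≤ n → S n)
                × (∀ c' → (∀ n → c' ≤ n → S n) → c ≤ c')

IsMultiplicity : Subset → ℕ → Set
IsMultiplicity S m = (0 < m) × S m × (∀ n → 0 < n → S n → m ≤ n)

-- ceiling division ⌈ a / m ⌉ (junk value 0 for m = 0, never used)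
ceilDiv : ℕ → ℕ → ℕ
ceilDiv a zero    = 0
ceilDiv a (suc k) = (a + k) / suc k

-- Parameters of the paper (p even, so p/2 and p²/4 are exact)
half : ℕ → ℕ
half p = p / 2

μ : ℕ → ℕ
μ p = half p * half p + 2 * p + 2

γ : ℕ → ℕ
γ p = 2 * μ p ∸ (half p + 4)

mP : ℕ → ℕ → ℕ
mP p τ = μ p + τ * half p

gP : ℕ → ℕ → ℕ
gP p τ = γ p + τ * (p ∸ 1)

cP : ℕ → ℕ → ℕ
cP p τ = p * μ p + τ * (p * p / 2 ∸ 1)

S : ℕ → ℕ → Subset
S p τ = ⟨ mP p τ , gP p τ , gP p τ + 1 ⟩[ cP p τ ]

mIJ : ℕ → ℕ → ℕ → ℕ → ℕ
mIJ p τ i j = mP p τ + j * half p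

gIJ : ℕ → ℕ → ℕ → ℕ → ℕ
gIJ p τ i j = gP p τ + j * (p ∸ 1) + i * mIJ p τ i j

cIJ : ℕ → ℕ → ℕ → ℕ → ℕ
cIJ p τ i j = cP p τ + j * (p * p / 2) + i * (half p + 1) * mIJ p τ i j

SIJ : ℕ → ℕ → ℕ → ℕ → Subset
SIJ p τ i j = ⟨ mIJ p τ i j , gIJ p τ i j , gIJ p τ i j + 1 ⟩[ cIJ p τ i j ]

module Submission where

-- Write p = 2K and d = K + 4 + τ + j. Then m⁽ⁱʲ⁾ = K d + 2, g⁽ⁱʲ⁾ + d = (2 + i) m⁽ⁱʲ⁾ and
-- c⁽ⁱʲ⁾ + τ = ((2 + i) K + i) m⁽ⁱʲ⁾ with τ < m⁽ⁱʲ⁾, so q(S⁽ⁱʲ⁾) = (2 + i) K + i as soon as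
-- c⁽ⁱʲ⁾ and m⁽ⁱʲ⁾ are the conductor and the multiplicity; S = S⁽⁰⁰⁾ then gives q(S) = 2K.
-- The multiplicity is clear from m⁽ⁱʲ⁾ < g⁽ⁱʲ⁾ < c⁽ⁱʲ⁾. For the conductor, c⁽ⁱʲ⁾ - 1 must be a
-- gap: writing it as x m + s g + z with z ≤ s and substituting g = (2 + i) m - d gives
-- P m + (z + 1 + τ) = A m + s d with P = x + (2 + i) s and A = (2 + i) K + i, and each of
-- P < A, P = A, P > A contradicts K d + 2 = m, d < m, τ + 2 < d by a size comparison.

open import Data.Empty using (⊥; ⊥-elim)
open import Data.Nat
open import Data.Nat.DivMod using (_/_; m*n/n≡m; +-distrib-/-∣ˡ; m<n⇒m/n≡0)
open import Data.Nat.Divisibility using (_∣_; divides)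
open import Data.Nat.Properties
open import Data.Nat.Tactic.RingSolver using (solve-∀)
open import Data.Product using (∃-syntax; _×_; _,_)
open import Data.Sum using (inj₁; inj₂)
open import Relation.Binary using (Tri; tri<; tri≈; tri>)
open import Relation.Binary.PropositionalEquality
open import Relation.Nullary using (¬_)

open import Defs

ceilDiv-deficit : ∀ {t r A a} → t + r ≡ A * a → r < a → ceilDiv t a ≡ A
ceilDiv-deficit {t} {r} {A} {suc a} t+r≡Aa (s≤s r≤a) with m≤n⇒∃[o]m+o≡n r≤a
... | w , r+w≡a = begin
  (t + a) / suc a               ≡⟨ cong (λ v → (t + v) / suc a) (sym r+w≡a) ⟩
  (t + (r + w)) / suc a         ≡⟨ cong (_/ suc a) (sym (+-assoc t r w)) ⟩
  (t + r + w) / suc a           ≡⟨ cong (λ v → (v + w) / suc a) t+r≡Aa ⟩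
  (A * suc a + w) / suc a       ≡⟨ +-distrib-/-∣ˡ w (divides A refl) ⟩
  A * suc a / suc a + w / suc a ≡⟨ cong₂ _+_ (m*n/n≡m A (suc a)) (m<n⇒m/n≡0 w<1+a) ⟩
  A + 0                         ≡⟨ +-identityʳ A ⟩
  A                             ∎
  where
  open ≡-Reasoning
  w<1+a : w < suc a
  w<1+a = s≤s (≤-trans (m≤n+m w r) (≤-reflexive r+w≡a))

-- x a + y b + z (b + 1) is recorded as x a + s b + z with s = y + z.
Combination : ℕ → ℕ → ℕ → Set
Combination a b n = ∃[ x ] ∃[ s ] ∃[ z ] z ≤ s × x * a + s * b + z ≡ n

combination-below : ∀ {a b t n} → ⟨ a , b , b + 1 ⟩[ t ] n → n < t → Combination a b n
combination-below zero∈ _ = 0 , 0 , 0 , z≤n , refl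
combination-below {a} a∈ _ = 1 , 0 , 0 , z≤n , trans (+-identityʳ _) (trans (+-identityʳ _) (*-identityˡ a))
combination-below {b = b} b∈ _ = 0 , 1 , 0 , z≤n , trans (+-identityʳ _) (*-identityˡ b)
combination-below {b = b} d∈ _ = 0 , 1 , 1 , s≤s z≤n , cong (_+ 1) (*-identityˡ b)
combination-below (big∈ t≤n) n<t = ⊥-elim (<⇒≱ n<t t≤n)
combination-below {a} {b} (add∈ {x} {y} x∈ y∈) x+y<t
  with combination-below x∈ (≤-<-trans (m≤m+n x y) x+y<t)
     | combination-below y∈ (≤-<-trans (m≤n+m y x) x+y<t)
... | x₁ , s₁ , z₁ , z₁≤s₁ , eq₁ | x₂ , s₂ , z₂ , z₂≤s₂ , eq₂ =
  x₁ + x₂ , s₁ + s₂ , z₁ + z₂ , +-mono-≤ z₁≤s₁ z₂≤s₂ ,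
  trans (interchange a b x₁ s₁ z₁ x₂ s₂ z₂) (cong₂ _+_ eq₁ eq₂)
  where
  interchange : ∀ a b x₁ s₁ z₁ x₂ s₂ z₂ →
    (x₁ + x₂) * a + (s₁ + s₂) * b + (z₁ + z₂) ≡ (x₁ * a + s₁ * b + z₁) + (x₂ * a + s₂ * b + z₂)
  interchange = solve-∀

smallest-generator≤ : ∀ {a b t n} → a ≤ b → a ≤ t → 0 < n → ⟨ a , b , b + 1 ⟩[ t ] n → a ≤ n
smallest-generator≤ a≤b a≤t () zero∈
smallest-generator≤ a≤b a≤t _ a∈ = ≤-refl
smallest-generator≤ a≤b a≤t _ b∈ = a≤b
smallest-generator≤ a≤b a≤t _ d∈ = ≤-trans a≤b (m≤m+n _ 1)
smallest-generator≤ a≤b a≤t _ (big∈ t≤n) = ≤-trans a≤t t≤n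
smallest-generator≤ a≤b a≤t pos (add∈ {zero} x∈ y∈) = smallest-generator≤ a≤b a≤t pos y∈
smallest-generator≤ a≤b a≤t _ (add∈ {suc x} {y} x∈ y∈) =
  ≤-trans (smallest-generator≤ a≤b a≤t (s≤s z≤n) x∈) (m≤m+n (suc x) y)

conductor-≡ : ∀ {A : Subset} {t c} → (∀ n → t ≤ n → A n) → (∀ {N} → suc N ≡ t → ¬ A N) →
  IsConductor A c → c ≡ t
conductor-≡ {t = t} {c} tail∈ gap (c-tail∈ , c-least) with ≤-<-connex t c
... | inj₁ t≤c = ≤-antisym (c-least t tail∈) t≤c
... | inj₂ c<t with m≤n⇒∃[o]m+o≡n c<t
...   | o , c+1+o≡t = ⊥-elim (gap c+1+o≡t (c-tail∈ (c + o) (m≤m+n c o)))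

+-*-cancelˡ-≡ : ∀ P u M q r → P * M + q ≡ (P + u) * M + r → q ≡ u * M + r
+-*-cancelˡ-≡ P u M q r eq = +-cancelˡ-≡ (P * M) q (u * M + r) (trans eq (regroup P u M r))
  where
  regroup : ∀ P u M r → (P + u) * M + r ≡ P * M + (u * M + r)
  regroup = solve-∀

not-multiple : ∀ {s d z τ} → z ≤ s → τ + 2 < d → z + 1 + τ ≢ s * d
not-multiple {zero} z≤n _ ()
not-multiple {suc s} {d} {z} {τ} z≤1+s τ+2<d eq = <-irrefl eq (begin-strict
  z + 1 + τ     ≤⟨ +-monoˡ-≤ τ (+-monoˡ-≤ 1 z≤1+s) ⟩
  suc s + 1 + τ ≡⟨ regroup s τ ⟩
  s + (τ + 2)   <⟨ +-monoʳ-< s τ+2<d ⟩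
  s + d         ≤⟨ +-monoˡ-≤ d (m≤m*n s d {{>-nonZero (≤-trans (s≤s z≤n) τ+2<d)}}) ⟩
  s * d + d     ≡⟨ +-comm (s * d) d ⟩
  suc s * d     ∎)
  where
  open ≤-Reasoning
  regroup : ∀ s τ → suc s + 1 + τ ≡ s + (τ + 2)
  regroup = solve-∀

multiple-bound : ∀ {M d k i s R} → k * d < M → d ≤ M → 0 < R →
  s * (2 + i) ≤ (2 + i) * k + i + R → s * d ≤ R * M
multiple-bound {M} {d} {k} {i} {s} {R} kd<M d≤M R>0 bound with ≤-<-connex s k
... | inj₁ s≤k = begin
  s * d ≤⟨ *-monoˡ-≤ d s≤k ⟩
  k * d ≤⟨ <⇒≤ kd<M ⟩
  M     ≤⟨ m≤n*m M R {{>-nonZero R>0}} ⟩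
  R * M ∎
  where open ≤-Reasoning
... | inj₂ k<s with m≤n⇒∃[o]m+o≡n k<s
...   | e , refl = begin
  (suc k + e) * d               ≡⟨ split k e d ⟩
  suc e * d + k * d             ≤⟨ +-mono-≤ (*-monoʳ-≤ (suc e) d≤M) (<⇒≤ kd<M) ⟩
  suc e * M + M                 ≤⟨ +-monoʳ-≤ (suc e * M) (m≤n*m M (suc e)) ⟩
  suc e * M + suc e * M         ≡⟨ sym (*-distribʳ-+ M (suc e) (suc e)) ⟩
  (suc e + suc e) * M           ≤⟨ *-monoˡ-≤ M 2[1+e]≤R ⟩
  R * M                         ∎
  where
  open ≤-Reasoning
  split : ∀ k e d → (suc k + e) * d ≡ suc e * d + k * d
  split = solve-∀
  -- s = k + 1 + e forces R ≥ 2 (1 + e), which pays for the 1 + e extra copies of d ≤ M.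
  expand : ∀ k e i → (suc k + e) * (2 + i) ≡ (2 + i) * k + i + (suc e + suc e + i * e)
  expand = solve-∀
  2[1+e]≤R : suc e + suc e ≤ R
  2[1+e]≤R = m+n≤o⇒m≤o (suc e + suc e)
    (+-cancelˡ-≤ ((2 + i) * k + i) _ _ (subst (_≤ (2 + i) * k + i + R) (expand k e i) bound))

no-gap-representation : ∀ {M d k i τ P s z} → k * d < M → d < M → τ + 2 < d → z ≤ s →
  s * (2 + i) ≤ P → P * M + (z + 1 + τ) ≢ ((2 + i) * k + i) * M + s * d
no-gap-representation {M} {d} {k} {i} {τ} {P} {s} {z} kd<M d<M τ+2<d z≤s s[2+i]≤P eq
  = trichotomy (<-cmp P A)
  where
  open ≤-Reasoning
  A q : ℕ
  A = (2 + i) * k + i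
  q = z + 1 + τ

  below : P < A → ⊥
  below P<A with m≤n⇒∃[o]m+o≡n P<A
  ... | u , 1+P+u≡A = <⇒≱ 1+τ<M (+-cancelˡ-≤ z M (1 + τ) (begin
    z + M              ≡⟨ +-comm z M ⟩
    M + z              ≤⟨ +-monoʳ-≤ M z≤sd ⟩
    M + s * d          ≤⟨ +-monoˡ-≤ (s * d) (m≤m+n M (u * M)) ⟩
    suc u * M + s * d  ≡⟨ sym (+-*-cancelˡ-≡ P (suc u) M q (s * d) (subst (λ B → P * M + q ≡ B * M + s * d) A≡P+1+u eq)) ⟩
    z + 1 + τ          ≡⟨ +-assoc z 1 τ ⟩
    z + (1 + τ)        ∎))
    where
    A≡P+1+u : A ≡ P + suc u
    A≡P+1+u = sym (trans (+-suc P u) 1+P+u≡A)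
    1+τ<M : 1 + τ < M
    1+τ<M = ≤-trans (≤-reflexive (+-comm 2 τ)) (<⇒≤ (<-trans τ+2<d d<M))
    z≤sd : z ≤ s * d
    z≤sd = ≤-trans z≤s (m≤m*n s d {{>-nonZero (≤-trans (s≤s z≤n) τ+2<d)}})

  above : A < P → ⊥
  above A<P with m≤n⇒∃[o]m+o≡n A<P
  ... | r , 1+A+r≡P = <⇒≱ (begin-strict
    suc r * M      <⟨ m<m+n (suc r * M) (≤-trans (m≤n+m 1 z) (m≤m+n (z + 1) τ)) ⟩
    suc r * M + q  ≡⟨ sym (+-*-cancelˡ-≡ A (suc r) M (s * d) q (subst (λ B → A * M + s * d ≡ B * M + q) P≡A+1+r (sym eq))) ⟩
    s * d          ∎)
    (multiple-bound {k = k} {i} {s} kd<M (<⇒≤ d<M) (s≤s z≤n) (≤-trans s[2+i]≤P (≤-reflexive P≡A+1+r)))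
    where
    P≡A+1+r : P ≡ A + suc r
    P≡A+1+r = sym (trans (+-suc A r) 1+A+r≡P)

  trichotomy : Tri (P < A) (P ≡ A) (A < P) → ⊥
  trichotomy (tri< P<A _ _) = below P<A
  trichotomy (tri≈ _ P≡A _) =
    not-multiple z≤s τ+2<d (+-cancelˡ-≡ (A * M) _ _ (subst (λ B → B * M + q ≡ A * M + s * d) P≡A eq))
  trichotomy (tri> _ _ A<P) = above A<P

predecessor-∉ : ∀ {M G t d τ i k N} →
  G + d ≡ (2 + i) * M → t + τ ≡ ((2 + i) * k + i) * M → k * d < M → d < M → τ + 2 < d →
  suc N ≡ t → ¬ ⟨ M , G , G + 1 ⟩[ t ] N
predecessor-∉ {M} {G} {t} {d} {τ} {i} {k} {N} G+d≡ t+τ≡ kd<M d<M τ+2<d 1+N≡t N∈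
  with combination-below N∈ (≤-reflexive 1+N≡t)
... | x , s , z , z≤s , sum≡N =
  no-gap-representation {k = k} kd<M d<M τ+2<d z≤s (m≤n+m (s * (2 + i)) x) (begin
    (x + s * (2 + i)) * M + (z + 1 + τ)     ≡⟨ distribute x s i M (z + 1 + τ) ⟩
    x * M + s * ((2 + i) * M) + (z + 1 + τ) ≡⟨ cong (λ g → x * M + s * g + (z + 1 + τ)) (sym G+d≡) ⟩
    x * M + s * (G + d) + (z + 1 + τ)       ≡⟨ regroup x M s G d z τ ⟩
    suc (x * M + s * G + z) + τ + s * d     ≡⟨ cong (λ n → suc n + τ + s * d) sum≡N ⟩
    suc N + τ + s * d                       ≡⟨ cong (λ n → n + τ + s * d) 1+N≡t ⟩
    t + τ + s * d                           ≡⟨ cong (_+ s * d) t+τ≡ ⟩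
    ((2 + i) * k + i) * M + s * d           ∎)
  where
  open ≡-Reasoning
  distribute : ∀ x s i M q → (x + s * (2 + i)) * M + q ≡ x * M + s * ((2 + i) * M) + q
  distribute = solve-∀
  regroup : ∀ x M s G d z τ → x * M + s * (G + d) + (z + 1 + τ) ≡ suc (x * M + s * G + z) + τ + s * d
  regroup = solve-∀

ceilDiv-conductor-multiplicity : ∀ {M G t d τ i k c m} →
  G + d ≡ (2 + i) * M → t + τ ≡ ((2 + i) * k + i) * M → k * d + 2 ≡ M → d < M → τ + 2 < d →
  IsConductor ⟨ M , G , G + 1 ⟩[ t ] c → IsMultiplicity ⟨ M , G , G + 1 ⟩[ t ] m →
  ceilDiv c m ≡ (2 + i) * k + i
ceilDiv-conductor-multiplicity {M} {G} {t} {d} {τ} {i} {k} {c} {m}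
  G+d≡ t+τ≡ kd+2≡M d<M τ+2<d conductor (m>0 , m∈ , m-least) =
  subst₂ (λ c m → ceilDiv c m ≡ A) (sym c≡t) (sym m≡M) (ceilDiv-deficit t+τ≡ τ<M)
  where
  open ≤-Reasoning
  A : ℕ
  A = (2 + i) * k + i

  τ<M : τ < M
  τ<M = <-trans (≤-<-trans (m≤m+n τ 2) τ+2<d) d<M

  kd<M : k * d < M
  kd<M = subst (k * d <_) kd+2≡M (m<m+n (k * d) (s≤s z≤n))

  M<G : M < G
  M<G = +-cancelʳ-< d M G (begin-strict
    M + d         <⟨ +-monoʳ-< M d<M ⟩
    M + M         ≤⟨ +-monoʳ-≤ M (m≤m+n M (i * M)) ⟩
    (2 + i) * M   ≡⟨ sym G+d≡ ⟩
    G + d         ∎)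

  k>0 : 0 < k
  k>0 = positive k kd+2≡M
    where
    positive : ∀ k → k * d + 2 ≡ M → 0 < k
    positive zero 2≡M = ⊥-elim (<⇒≱ (<-trans τ+2<d d<M) (≤-trans (≤-reflexive (sym 2≡M)) (m≤n+m 2 τ)))
    positive (suc _) _ = s≤s z≤n

  2≤A : 2 ≤ A
  2≤A = ≤-trans (m≤m+n 2 i) (≤-trans (m≤m*n (2 + i) k {{>-nonZero k>0}}) (m≤m+n _ i))

  M<t : M < t
  M<t = +-cancelʳ-< τ M t (begin-strict
    M + τ     <⟨ +-monoʳ-< M τ<M ⟩
    M + M     ≡⟨ cong (M +_) (sym (+-identityʳ M)) ⟩
    2 * M     ≤⟨ *-monoˡ-≤ M 2≤A ⟩
    A * M     ≡⟨ sym t+τ≡ ⟩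
    t + τ     ∎)

  c≡t : c ≡ t
  c≡t = conductor-≡ (λ _ → big∈) (predecessor-∉ {k = k} G+d≡ t+τ≡ kd<M d<M τ+2<d) conductor

  m≡M : m ≡ M
  m≡M = ≤-antisym (m-least M (≤-trans (s≤s z≤n) (<-trans τ+2<d d<M)) a∈)
                  (smallest-generator≤ (<⇒≤ M<G) (<⇒≤ M<t) m>0 m∈)

module EvenParameters (n : ℕ) where

  K p : ℕ
  K = suc n
  p = K * 2

  d : ℕ → ℕ → ℕ
  d τ j = K + 4 + (τ + j)

  half-p : half p ≡ K
  half-p = m*n/n≡m K 2

  μ-p : μ p ≡ K * K + 4 * K + 2
  μ-p = trans (cong (λ h → h * h + 2 * p + 2) half-p) (collect K)
    where
    collect : ∀ K → K * K + 2 * (K * 2) + 2 ≡ K * K + 4 * K + 2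
    collect = solve-∀

  γ-p : γ p ≡ 2 * K * K + 7 * K
  γ-p = begin
    2 * μ p ∸ (half p + 4)                         ≡⟨ cong₂ (λ u h → 2 * u ∸ (h + 4)) μ-p half-p ⟩
    2 * (K * K + 4 * K + 2) ∸ (K + 4)              ≡⟨ cong (_∸ (K + 4)) (split K) ⟩
    (2 * K * K + 7 * K) + (K + 4) ∸ (K + 4)        ≡⟨ m+n∸n≡m (2 * K * K + 7 * K) (K + 4) ⟩
    2 * K * K + 7 * K                              ∎
    where
    open ≡-Reasoning
    split : ∀ K → 2 * (K * K + 4 * K + 2) ≡ (2 * K * K + 7 * K) + (K + 4)
    split = solve-∀

  p²/2 : p * p / 2 ≡ 2 * K * K
  p²/2 = trans (cong (_/ 2) (regroup K)) (m*n/n≡m (2 * K * K) 2)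
    where
    regroup : ∀ K → K * 2 * (K * 2) ≡ 2 * K * K * 2
    regroup = solve-∀

  p²/2∸1 : p * p / 2 ∸ 1 ≡ 2 * n * n + 4 * n + 1
  p²/2∸1 = cong (_∸ 1) (trans p²/2 (expand n))
    where
    expand : ∀ n → 2 * suc n * suc n ≡ suc (2 * n * n + 4 * n + 1)
    expand = solve-∀

  mIJ-p : ∀ τ i j → mIJ p τ i j ≡ K * d τ j + 2
  mIJ-p τ i j = trans (cong₂ (λ u h → u + τ * h + j * h) μ-p half-p) (factor K τ j)
    where
    factor : ∀ K τ j → K * K + 4 * K + 2 + τ * K + j * K ≡ K * (K + 4 + (τ + j)) + 2
    factor = solve-∀

  gIJ-p : ∀ τ i j → gIJ p τ i j + d τ j ≡ (2 + i) * mIJ p τ i j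
  gIJ-p τ i j = begin
    γ p + τ * (p ∸ 1) + j * (p ∸ 1) + i * w + d τ j
      ≡⟨ cong (λ g → g + τ * (p ∸ 1) + j * (p ∸ 1) + i * w + d τ j) γ-p ⟩
    2 * K * K + 7 * K + τ * suc (n * 2) + j * suc (n * 2) + i * w + (K + 4 + (τ + j))
      ≡⟨ collect n τ j i w ⟩
    2 * (K * d τ j + 2) + i * w
      ≡⟨ cong (λ v → 2 * v + i * w) (sym (mIJ-p τ i j)) ⟩
    2 * w + i * w
      ≡⟨ sym (*-distribʳ-+ w 2 i) ⟩
    (2 + i) * w
      ∎
    where
    open ≡-Reasoning
    w = mIJ p τ i j
    collect : ∀ n τ j i w →
      2 * suc n * suc n + 7 * suc n + τ * suc (n * 2) + j * suc (n * 2) + i * w + (suc n + 4 + (τ + j))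
        ≡ 2 * (suc n * (suc n + 4 + (τ + j)) + 2) + i * w
    collect = solve-∀

  cIJ-p : ∀ τ i j → cIJ p τ i j + τ ≡ ((2 + i) * K + i) * mIJ p τ i j
  cIJ-p τ i j = begin
    p * μ p + τ * (p * p / 2 ∸ 1) + j * (p * p / 2) + i * (half p + 1) * w + τ
      ≡⟨ cong₂ (λ u v → p * u + τ * v + j * (p * p / 2) + i * (half p + 1) * w + τ) μ-p p²/2∸1 ⟩
    p * (K * K + 4 * K + 2) + τ * (2 * n * n + 4 * n + 1) + j * (p * p / 2) + i * (half p + 1) * w + τ
      ≡⟨ cong₂ (λ v h → p * (K * K + 4 * K + 2) + τ * (2 * n * n + 4 * n + 1) + j * v + i * (h + 1) * w + τ) p²/2 half-p ⟩
    p * (K * K + 4 * K + 2) + τ * (2 * n * n + 4 * n + 1) + j * (2 * K * K) + i * (K + 1) * w + τ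
      ≡⟨ collect n τ j i w ⟩
    p * (K * d τ j + 2) + i * (K + 1) * w
      ≡⟨ cong (λ v → p * v + i * (K + 1) * w) (sym (mIJ-p τ i j)) ⟩
    p * w + i * (K + 1) * w
      ≡⟨ factor K i w ⟩
    ((2 + i) * K + i) * w
      ∎
    where
    open ≡-Reasoning
    w = mIJ p τ i j
    collect : ∀ n τ j i w →
      suc n * 2 * (suc n * suc n + 4 * suc n + 2) + τ * (2 * n * n + 4 * n + 1) + j * (2 * suc n * suc n)
        + i * (suc n + 1) * w + τ
        ≡ suc n * 2 * (suc n * (suc n + 4 + (τ + j)) + 2) + i * (suc n + 1) * w
    collect = solve-∀
    factor : ∀ K i w → K * 2 * w + i * (K + 1) * w ≡ ((2 + i) * K + i) * w
    factor = solve-∀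

  d<mIJ : ∀ τ i j → d τ j < mIJ p τ i j
  d<mIJ τ i j = subst (d τ j <_) (sym (mIJ-p τ i j))
    (≤-<-trans (m≤n*m (d τ j) K) (m<m+n (K * d τ j) (s≤s z≤n)))

  τ+2<d : ∀ τ j → τ + 2 < d τ j
  τ+2<d τ j = subst (τ + 2 <_) (sym (split n τ j)) (m≤m+n (suc (τ + 2)) (n + 2 + j))
    where
    split : ∀ n τ j → suc n + 4 + (τ + j) ≡ suc (τ + 2) + (n + 2 + j)
    split = solve-∀

  q-SIJ : ∀ τ i j {c m} → IsConductor (SIJ p τ i j) c → IsMultiplicity (SIJ p τ i j) m →
    ceilDiv c m ≡ (2 + i) * K + i
  q-SIJ τ i j = ceilDiv-conductor-multiplicity {i = i} {k = K}
    (gIJ-p τ i j) (cIJ-p τ i j) (sym (mIJ-p τ i j)) (d<mIJ τ i j) (τ+2<d τ j)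

semigroup-cong : ∀ {a a′ b b′ t t′} → a ≡ a′ → b ≡ b′ → t ≡ t′ →
  ⟨ a , b , b + 1 ⟩[ t ] ≡ ⟨ a′ , b′ , b′ + 1 ⟩[ t′ ]
semigroup-cong refl refl refl = refl

S≡SIJ₀₀ : ∀ p τ → S p τ ≡ SIJ p τ 0 0
S≡SIJ₀₀ p τ = semigroup-cong
  (sym (+-identityʳ (mP p τ)))
  (sym (trans (+-identityʳ _) (+-identityʳ (gP p τ))))
  (sym (trans (+-identityʳ _) (+-identityʳ (cP p τ))))

lemma5p7 : ∀ (p τ i j : ℕ) → 2 ∣ p → 0 < p →
    ∀ (c m c' m' : ℕ) →
    IsConductor (S p τ) c → IsMultiplicity (S p τ) m →
    IsConductor (SIJ p τ i j) c' → IsMultiplicity (SIJ p τ i j) m' →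
    ceilDiv c' m' ≡ ceilDiv c m + i * (half p + 1)
lemma5p7 .(zero * 2) τ i j (divides zero refl) ()
lemma5p7 .(suc n * 2) τ i j (divides (suc n) refl) _ c m c' m' hc hm hc' hm' = begin
  ceilDiv c' m'                    ≡⟨ q-SIJ τ i j hc' hm' ⟩
  (2 + i) * K + i                  ≡⟨ split K i ⟩
  (2 + 0) * K + 0 + i * (K + 1)    ≡⟨ cong₂ (λ q h → q + i * (h + 1)) (sym q-S) (sym half-p) ⟩
  ceilDiv c m + i * (half p + 1)   ∎
  where
  open ≡-Reasoning
  open EvenParameters n
  q-S : ceilDiv c m ≡ (2 + 0) * K + 0
  q-S = q-SIJ τ 0 0 (subst (λ A → IsConductor A c) (S≡SIJ₀₀ p τ) hc)
                    (subst (λ A → IsMultiplicity A m) (S≡SIJ₀₀ p τ) hm)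
  split : ∀ K i → (2 + i) * K + i ≡ (2 + 0) * K + 0 + i * (K + 1)
  split = solve-∀
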